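{- Let $\mathrm{bs}$ be the Baum–Sweet sequence: $\mathrm{bs}(n) = 0$ if the base-$2$ representation of $n$ contains a maximal block of consecutive zeros of odd length, and $\mathrm{bs}(n) = 1$ otherwise. Then the running sum $\mathrm{sum}_{\mathrm{bs}}(n) = \sum_{i=0}^{n} \mathrm{bs}(i)$ is not $2$-synchronised.
   Context: A function $f:\mathbb{N}\to\mathbb{N}$ is $2$-synchronised if there is a finite automaton which, reading the base-$2$ representations of $n$ and $m$ in parallel (most significant digit first, the shorter padded with leading zeros), accepts exactly the pairs $(n,m)$ with $m = f(n)$. -}

module Defs where

open import Data.Nat using (ℕ; zero; suc; _+_; _∸_; _⊔_; _%_; _/_; _≡ᵇ_)
open import Data.Bool using (Bool; true; false)
open import Data.List using (List; []; _∷_; reverse; length; replicate; _++_; zip; foldl; map; upTo)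
open import Data.Nat.ListAction using (sum)
open import Data.List.Relation.Unary.Any using (Any)
open import Data.Nat.Properties using (_≟_)
open import Data.Fin using (Fin)
open import Data.Product using (Σ; _×_; _,_)
open import Relation.Binary.PropositionalEquality using (_≡_)
open import Relation.Nullary using (Dec; yes; no)
open import Function.Bundles using (_⇔_)

-- Binary digits, least significant first (fuel argument guarantees termination;
-- fuel n suffices for n since each step halves n).
bitsLSB : ℕ → ℕ → List Bool
bitsLSB zero    _ = []
bitsLSB (suc f) zero = []
bitsLSB (suc f) n@(suc _) = (n % 2 ≡ᵇ 1) ∷ bitsLSB f (n / 2)

-- Canonical base-2 representation, most significant digit first,
-- no leading zeros (so 0 is represented by the empty word).
bits : ℕ → List Bool
bits n = reverse (bitsLSB n n)

-- Lengths of the maximal blocks of consecutive zeros (false) in a word.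
-- c = length of the current (unfinished) block of zeros.
zeroRunsFrom : ℕ → List Bool → List ℕ
zeroRunsFrom zero      []            = []
zeroRunsFrom c@(suc _) []            = c ∷ []
zeroRunsFrom c         (false ∷ xs)  = zeroRunsFrom (suc c) xs
zeroRunsFrom zero      (true ∷ xs)   = zeroRunsFrom zero xs
zeroRunsFrom c@(suc _) (true ∷ xs)   = c ∷ zeroRunsFrom zero xs

zeroRuns : List Bool → List ℕ
zeroRuns = zeroRunsFrom zero

isOdd : ℕ → Bool
isOdd n = n % 2 ≡ᵇ 1

anyOdd : List ℕ → Bool
anyOdd []       = false
anyOdd (x ∷ xs) with isOdd x
... | true  = true
... | false = anyOdd xs

bs : ℕ → ℕ
bs n with anyOdd (zeroRuns (bits n))
... | true  = 0
... | false = 1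

sumBs : ℕ → ℕ
sumBs n = sum (map bs (upTo (suc n)))

record DFA (k : ℕ) : Set where
  field
    start  : Fin k
    step   : Fin k → Bool × Bool → Fin k
    accept : Fin k → Bool

run : ∀ {k} → DFA k → List (Bool × Bool) → Bool
run {k} A w = DFA.accept A (foldl (DFA.step A) (DFA.start A) w)

pad : ℕ → List Bool → List Bool
pad L w = replicate (L ∸ length w) false ++ w

pairWord : ℕ → ℕ → List (Bool × Bool)
pairWord n m = zip (pad L (bits n)) (pad L (bits m))
  where L = length (bits n) ⊔ length (bits m)

Synchronised2 : (ℕ → ℕ) → Set
Synchronised2 f =
  Σ ℕ λ k → Σ (DFA k) λ A → ∀ n m → (run A (pairWord n m) ≡ true) ⇔ (m ≡ f n)

{-# OPTIONS --safe #-}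
module Submission where

-- Let S x = Σ_{i<x} bs i and E x = Σ_{i<x} bs (2i). From bs (2i+1) = bs i, bs (4i) = bs i and
-- bs (4i+2) = 0 one gets S (2x) = E x + S x and E (2x) = S x, so S + E at most triples when x is
-- multiplied by 4, and sumBs (4^J) ≤ 3^(J+1). For J = 6 + 3k the binary word of m = sumBs (4^J) is
-- therefore shorter than 2J - k, while 4^J is a 1 followed by 2J zeros: an automaton with k states
-- accepting (4^J, m) reads at least k letters (0,0) before the digits of m begin. Pumping that block
-- twice (so the number of zeros stays even) makes it accept (4^J′, m) for some J′ > J; but
-- bs (4^J′) = 1, so sumBs (4^J′) > sumBs (4^J) = m.

open import Defs
open import Data.Bool using (Bool; true; false; _∨_)
open import Data.Bool.Properties using (∨-zeroʳ)
open import Data.Fin using (Fin; toℕ)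
open import Data.Fin.Properties using (pigeonhole; toℕ<n)
open import Data.List using (List; []; _∷_; [_]; _++_; _∷ʳ_; reverse; length; replicate; zip; foldl; map; upTo)
open import Data.List.Properties using (++-assoc; unfold-reverse; length-reverse; length-replicate; foldl-++; map-++; upTo-∷ʳ)
open import Data.Nat using (ℕ; zero; suc; _+_; _*_; _∸_; _^_; _≤_; _<_; _⊔_; _%_; _/_; _≡ᵇ_; z≤n; s≤s; NonZero)
open import Data.Nat.DivMod using (m*n%n≡0; m*n/n≡m; [m+n]%n≡m%n; [m+kn]%n≡m%n; +-distrib-/-∣ʳ; m/n<m; m<n*o⇒m/o<n)
open import Data.Nat.Divisibility using (m∣m*n)
open import Data.Nat.GeneralisedArithmetic using (iterate)
open import Data.Nat.ListAction using (sum)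
open import Data.Nat.ListAction.Properties using (sum-++)
open import Data.Nat.Properties
open import Algebra.Properties.CommutativeSemigroup +-commutativeSemigroup using (xy∙z≈xz∙y)
open import Data.Nat.Tactic.RingSolver using (solve-∀)
open import Data.Product using (∃-syntax; _×_; _,_)
open import Data.Unit using (tt)
open import Function.Bundles using (Equivalence)
open import Relation.Binary.PropositionalEquality using (_≡_; refl; sym; trans; cong; cong₂; subst; module ≡-Reasoning)
open import Relation.Nullary using (¬_; contradiction)

private
  variable
    A B : Set

replicate-++ : ∀ m n (x : A) → replicate m x ++ replicate n x ≡ replicate (m + n) x
replicate-++ zero    n x = refl
replicate-++ (suc m) n x = cong (x ∷_) (replicate-++ m n x)

zip-replicate-++ : ∀ n (x : A) (y : B) xs ys →
  zip (replicate n x ++ xs) (replicate n y ++ ys) ≡ replicate n (x , y) ++ zip xs ys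
zip-replicate-++ zero    x y xs ys = refl
zip-replicate-++ (suc n) x y xs ys = cong ((x , y) ∷_) (zip-replicate-++ n x y xs ys)

[1+n]/2≤n : ∀ n → suc n / 2 ≤ n
[1+n]/2≤n n = ≤-pred (m/n<m (suc n) 2 ≤-refl)

bitsLSB-fuelIrrelevant : ∀ f f′ n → n ≤ f → n ≤ f′ → bitsLSB f n ≡ bitsLSB f′ n
bitsLSB-fuelIrrelevant zero    zero     zero    _         _          = refl
bitsLSB-fuelIrrelevant zero    (suc f′) zero    _         _          = refl
bitsLSB-fuelIrrelevant (suc f) zero     zero    _         _          = refl
bitsLSB-fuelIrrelevant (suc f) (suc f′) zero    _         _          = refl
bitsLSB-fuelIrrelevant (suc f) (suc f′) (suc n) (s≤s n≤f) (s≤s n≤f′) =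
  cong (_ ∷_) (bitsLSB-fuelIrrelevant f f′ (suc n / 2) (≤-trans h≤n n≤f) (≤-trans h≤n n≤f′))
  where h≤n = [1+n]/2≤n n

bits-unfold : ∀ n .{{_ : NonZero n}} → bits n ≡ bits (n / 2) ++ [ n % 2 ≡ᵇ 1 ]
bits-unfold n@(suc m) = begin
  reverse ((n % 2 ≡ᵇ 1) ∷ bitsLSB m (n / 2))     ≡⟨ unfold-reverse _ (bitsLSB m (n / 2)) ⟩
  reverse (bitsLSB m (n / 2)) ∷ʳ (n % 2 ≡ᵇ 1)     ≡⟨ cong (λ w → reverse w ∷ʳ (n % 2 ≡ᵇ 1)) (bitsLSB-fuelIrrelevant m (n / 2) (n / 2) ([1+n]/2≤n m) ≤-refl) ⟩
  bits (n / 2) ++ [ n % 2 ≡ᵇ 1 ]                  ∎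
  where open ≡-Reasoning

2*n%2≡0 : ∀ n → 2 * n % 2 ≡ 0
2*n%2≡0 n = trans (cong (_% 2) (*-comm 2 n)) (m*n%n≡0 n 2)

[1+2*n]%2≡1 : ∀ n → (1 + 2 * n) % 2 ≡ 1
[1+2*n]%2≡1 n = trans (cong (λ x → (1 + x) % 2) (*-comm 2 n)) ([m+kn]%n≡m%n 1 n 2)

2*n/2≡n : ∀ n → 2 * n / 2 ≡ n
2*n/2≡n n = trans (cong (_/ 2) (*-comm 2 n)) (m*n/n≡m n 2)

[1+2*n]/2≡n : ∀ n → (1 + 2 * n) / 2 ≡ n
[1+2*n]/2≡n n = trans (+-distrib-/-∣ʳ 1 {d = 2} (m∣m*n n)) (2*n/2≡n n)

bits-2* : ∀ n .{{_ : NonZero n}} → bits (2 * n) ≡ bits n ++ [ false ]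
bits-2* n@(suc _) = trans (bits-unfold (2 * n))
  (cong₂ (λ q b → bits q ++ [ b ]) (2*n/2≡n n) (cong (_≡ᵇ 1) (2*n%2≡0 n)))

bits-1+2* : ∀ n → bits (1 + 2 * n) ≡ bits n ++ [ true ]
bits-1+2* n = trans (bits-unfold (1 + 2 * n))
  (cong₂ (λ q b → bits q ++ [ b ]) ([1+2*n]/2≡n n) (cong (_≡ᵇ 1) ([1+2*n]%2≡1 n)))

bits-2*2* : ∀ n .{{_ : NonZero n}} → bits (2 * (2 * n)) ≡ bits n ++ false ∷ false ∷ []
bits-2*2* n@(suc _) = trans (bits-2* (2 * n)) (trans (cong (_++ [ false ]) (bits-2* n)) (++-assoc (bits n) _ _))

bits-4^ : ∀ J → bits (4 ^ J) ≡ true ∷ replicate (2 * J) false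
bits-4^ zero    = refl
bits-4^ (suc J) = begin
  bits (4 * 4 ^ J)                                    ≡⟨ cong bits (*-assoc 2 2 (4 ^ J)) ⟩
  bits (2 * (2 * 4 ^ J))                              ≡⟨ bits-2*2* (4 ^ J) {{m^n≢0 4 J}} ⟩
  bits (4 ^ J) ++ replicate 2 false                   ≡⟨ cong (_++ replicate 2 false) (bits-4^ J) ⟩
  true ∷ (replicate (2 * J) false ++ replicate 2 false) ≡⟨ cong (true ∷_) (replicate-++ (2 * J) 2 false) ⟩
  true ∷ replicate (2 * J + 2) false                  ≡⟨ cong (λ n → true ∷ replicate n false) (2*J+2≡2*[1+J] J) ⟩
  true ∷ replicate (2 * suc J) false                  ∎
  where
  open ≡-Reasoning
  2*J+2≡2*[1+J] : ∀ J → 2 * J + 2 ≡ 2 * suc J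
  2*J+2≡2*[1+J] = solve-∀

length-bitsLSB-< : ∀ f m p → m < 2 ^ p → length (bitsLSB f m) ≤ p
length-bitsLSB-< zero    m       p       _ = z≤n
length-bitsLSB-< (suc f) zero    p       _ = z≤n
length-bitsLSB-< (suc f) (suc m) zero    (s≤s ())
length-bitsLSB-< (suc f) (suc m) (suc p) m<2^p =
  s≤s (length-bitsLSB-< f (suc m / 2) p (m<n*o⇒m/o<n (subst (suc m <_) (*-comm 2 (2 ^ p)) m<2^p)))

length-bits-< : ∀ m p → m < 2 ^ p → length (bits m) ≤ p
length-bits-< m p m<2^p = subst (_≤ p) (sym (length-reverse (bitsLSB m m))) (length-bitsLSB-< m m p m<2^p)

isOdd-2+ : ∀ c → isOdd (2 + c) ≡ isOdd c
isOdd-2+ c = cong (_≡ᵇ 1) (trans (cong (_% 2) (+-comm 2 c)) ([m+n]%n≡m%n c 2))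

anyOdd-∷ : ∀ c cs → anyOdd (c ∷ cs) ≡ isOdd c ∨ anyOdd cs
anyOdd-∷ c cs with isOdd c
... | true  = refl
... | false = refl

zeroRunsFrom-∷ʳ-true : ∀ c w → zeroRunsFrom c (w ∷ʳ true) ≡ zeroRunsFrom c w
zeroRunsFrom-∷ʳ-true zero    []          = refl
zeroRunsFrom-∷ʳ-true (suc c) []          = refl
zeroRunsFrom-∷ʳ-true zero    (false ∷ w) = zeroRunsFrom-∷ʳ-true 1 w
zeroRunsFrom-∷ʳ-true (suc c) (false ∷ w) = zeroRunsFrom-∷ʳ-true (2 + c) w
zeroRunsFrom-∷ʳ-true zero    (true ∷ w)  = zeroRunsFrom-∷ʳ-true zero w
zeroRunsFrom-∷ʳ-true (suc c) (true ∷ w)  = cong (suc c ∷_) (zeroRunsFrom-∷ʳ-true zero w)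

anyOdd-zeroRunsFrom-++-false-false : ∀ c w → anyOdd (zeroRunsFrom c (w ++ false ∷ false ∷ [])) ≡ anyOdd (zeroRunsFrom c w)
anyOdd-zeroRunsFrom-++-false-false zero    []          = refl
anyOdd-zeroRunsFrom-++-false-false (suc c) []          = begin
  anyOdd [ 3 + c ]      ≡⟨ anyOdd-∷ (3 + c) [] ⟩
  isOdd (3 + c) ∨ false ≡⟨ cong (_∨ false) (isOdd-2+ (suc c)) ⟩
  isOdd (1 + c) ∨ false ≡⟨ anyOdd-∷ (1 + c) [] ⟨
  anyOdd [ 1 + c ]      ∎
  where open ≡-Reasoning
anyOdd-zeroRunsFrom-++-false-false zero    (false ∷ w) = anyOdd-zeroRunsFrom-++-false-false 1 w
anyOdd-zeroRunsFrom-++-false-false (suc c) (false ∷ w) = anyOdd-zeroRunsFrom-++-false-false (2 + c) w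
anyOdd-zeroRunsFrom-++-false-false zero    (true ∷ w)  = anyOdd-zeroRunsFrom-++-false-false zero w
anyOdd-zeroRunsFrom-++-false-false (suc c) (true ∷ w)  =
  trans (anyOdd-∷ (suc c) _) (trans (cong (isOdd (suc c) ∨_) (anyOdd-zeroRunsFrom-++-false-false zero w)) (sym (anyOdd-∷ (suc c) _)))

anyOdd-zeroRunsFrom-++-true-false : ∀ c w → anyOdd (zeroRunsFrom c (w ++ true ∷ false ∷ [])) ≡ true
anyOdd-zeroRunsFrom-++-true-false zero    []          = refl
anyOdd-zeroRunsFrom-++-true-false (suc c) []          = trans (anyOdd-∷ (suc c) _) (∨-zeroʳ (isOdd (suc c)))
anyOdd-zeroRunsFrom-++-true-false zero    (false ∷ w) = anyOdd-zeroRunsFrom-++-true-false 1 w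
anyOdd-zeroRunsFrom-++-true-false (suc c) (false ∷ w) = anyOdd-zeroRunsFrom-++-true-false (2 + c) w
anyOdd-zeroRunsFrom-++-true-false zero    (true ∷ w)  = anyOdd-zeroRunsFrom-++-true-false zero w
anyOdd-zeroRunsFrom-++-true-false (suc c) (true ∷ w)  =
  trans (anyOdd-∷ (suc c) _) (trans (cong (isOdd (suc c) ∨_) (anyOdd-zeroRunsFrom-++-true-false zero w)) (∨-zeroʳ (isOdd (suc c))))

hasOddZeroRun : List Bool → Bool
hasOddZeroRun w = anyOdd (zeroRuns w)

hasOddZeroRun≡⇒bs≡ : ∀ m n → hasOddZeroRun (bits m) ≡ hasOddZeroRun (bits n) → bs m ≡ bs n
hasOddZeroRun≡⇒bs≡ m n eq with hasOddZeroRun (bits m) | hasOddZeroRun (bits n)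
... | true  | true  = refl
... | false | false = refl
... | true  | false = contradiction eq λ ()
... | false | true  = contradiction eq λ ()

hasOddZeroRun⇒bs≡0 : ∀ n → hasOddZeroRun (bits n) ≡ true → bs n ≡ 0
hasOddZeroRun⇒bs≡0 n eq with hasOddZeroRun (bits n)
... | true = refl
... | false = contradiction eq λ ()

bs-1+2* : ∀ n → bs (1 + 2 * n) ≡ bs n
bs-1+2* n = hasOddZeroRun≡⇒bs≡ (1 + 2 * n) n
  (trans (cong hasOddZeroRun (bits-1+2* n)) (cong anyOdd (zeroRunsFrom-∷ʳ-true zero (bits n))))

bs-2*2* : ∀ n → bs (2 * (2 * n)) ≡ bs n
bs-2*2* zero        = refl
bs-2*2* n@(suc _) = hasOddZeroRun≡⇒bs≡ (2 * (2 * n)) n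
  (trans (cong hasOddZeroRun (bits-2*2* n)) (anyOdd-zeroRunsFrom-++-false-false zero (bits n)))

bs-2*[1+2*] : ∀ n → bs (2 * (1 + 2 * n)) ≡ 0
bs-2*[1+2*] n = hasOddZeroRun⇒bs≡0 (2 * (1 + 2 * n)) (begin
  hasOddZeroRun (bits (2 * (1 + 2 * n)))        ≡⟨ cong hasOddZeroRun (bits-2* (1 + 2 * n)) ⟩
  hasOddZeroRun (bits (1 + 2 * n) ++ [ false ])  ≡⟨ cong (λ w → hasOddZeroRun (w ++ [ false ])) (bits-1+2* n) ⟩
  hasOddZeroRun ((bits n ++ [ true ]) ++ [ false ]) ≡⟨ cong hasOddZeroRun (++-assoc (bits n) [ true ] [ false ]) ⟩
  hasOddZeroRun (bits n ++ true ∷ false ∷ [])    ≡⟨ anyOdd-zeroRunsFrom-++-true-false zero (bits n) ⟩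
  true                                           ∎)
  where open ≡-Reasoning

bs-4^ : ∀ J → bs (4 ^ J) ≡ 1
bs-4^ zero    = refl
bs-4^ (suc J) = trans (cong bs (*-assoc 2 2 (4 ^ J))) (trans (bs-2*2* (4 ^ J)) (bs-4^ J))

sumBelow : (ℕ → ℕ) → ℕ → ℕ
sumBelow f n = sum (map f (upTo n))

sumBelow-suc : ∀ f n → sumBelow f (suc n) ≡ sumBelow f n + f n
sumBelow-suc f n = begin
  sum (map f (upTo (suc n)))      ≡⟨ cong (λ xs → sum (map f xs)) (upTo-∷ʳ n) ⟨
  sum (map f (upTo n ∷ʳ n))       ≡⟨ cong sum (map-++ f (upTo n) [ n ]) ⟩
  sum (map f (upTo n) ++ [ f n ]) ≡⟨ sum-++ (map f (upTo n)) [ f n ] ⟩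
  sumBelow f n + (f n + 0)        ≡⟨ cong (sumBelow f n +_) (+-identityʳ (f n)) ⟩
  sumBelow f n + f n              ∎
  where open ≡-Reasoning

sumBelow-cong : ∀ {f g} → (∀ i → f i ≡ g i) → ∀ n → sumBelow f n ≡ sumBelow g n
sumBelow-cong f≗g zero    = refl
sumBelow-cong f≗g (suc n) = trans (sumBelow-suc _ n) (trans (cong₂ _+_ (sumBelow-cong f≗g n) (f≗g n)) (sym (sumBelow-suc _ n)))

sumBelow-zero : ∀ {f} → (∀ i → f i ≡ 0) → ∀ n → sumBelow f n ≡ 0
sumBelow-zero f≗0 zero    = refl
sumBelow-zero f≗0 (suc n) = trans (sumBelow-suc _ n) (cong₂ _+_ (sumBelow-zero f≗0 n) (f≗0 n))

sumBelow-≤-+ : ∀ f d m → sumBelow f m ≤ sumBelow f (d + m)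
sumBelow-≤-+ f zero    m = ≤-refl
sumBelow-≤-+ f (suc d) m = ≤-trans (sumBelow-≤-+ f d m) (≤-trans (m≤m+n _ _) (≤-reflexive (sym (sumBelow-suc f (d + m)))))

sumBelow-mono-≤ : ∀ f {m n} → m ≤ n → sumBelow f m ≤ sumBelow f n
sumBelow-mono-≤ f {m} {n} m≤n = subst (λ k → sumBelow f m ≤ sumBelow f k) (m∸n+n≡m m≤n) (sumBelow-≤-+ f (n ∸ m) m)

sumBelow-2* : ∀ f n → sumBelow f (2 * n) ≡ sumBelow (λ i → f (2 * i)) n + sumBelow (λ i → f (1 + 2 * i)) n
sumBelow-2* f zero    = refl
sumBelow-2* f (suc n) = begin
  sumBelow f (2 * suc n)                   ≡⟨ cong (sumBelow f) (*-suc 2 n) ⟩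
  sumBelow f (suc (suc (2 * n)))           ≡⟨ sumBelow-suc f (suc (2 * n)) ⟩
  sumBelow f (suc (2 * n)) + f (1 + 2 * n) ≡⟨ cong (_+ f (1 + 2 * n)) (sumBelow-suc f (2 * n)) ⟩
  sumBelow f (2 * n) + f (2 * n) + f (1 + 2 * n)
    ≡⟨ cong (λ s → s + f (2 * n) + f (1 + 2 * n)) (sumBelow-2* f n) ⟩
  E + O + f (2 * n) + f (1 + 2 * n)        ≡⟨ interchange E O (f (2 * n)) (f (1 + 2 * n)) ⟩
  (E + f (2 * n)) + (O + f (1 + 2 * n))    ≡⟨ cong₂ _+_ (sumBelow-suc _ n) (sumBelow-suc _ n) ⟨
  sumBelow (λ i → f (2 * i)) (suc n) + sumBelow (λ i → f (1 + 2 * i)) (suc n) ∎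
  where
  open ≡-Reasoning
  E = sumBelow (λ i → f (2 * i)) n
  O = sumBelow (λ i → f (1 + 2 * i)) n
  interchange : ∀ a b c d → a + b + c + d ≡ (a + c) + (b + d)
  interchange = solve-∀

sumBelow-bs-2* : ∀ n → sumBelow bs (2 * n) ≡ sumBelow (λ i → bs (2 * i)) n + sumBelow bs n
sumBelow-bs-2* n = trans (sumBelow-2* bs n) (cong (sumBelow (λ i → bs (2 * i)) n +_) (sumBelow-cong bs-1+2* n))

sumBelow-bs-even-2* : ∀ n → sumBelow (λ i → bs (2 * i)) (2 * n) ≡ sumBelow bs n
sumBelow-bs-even-2* n = begin
  sumBelow (λ i → bs (2 * i)) (2 * n)                        ≡⟨ sumBelow-2* (λ i → bs (2 * i)) n ⟩
  sumBelow (λ i → bs (2 * (2 * i))) n + sumBelow (λ i → bs (2 * (1 + 2 * i))) n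
    ≡⟨ cong₂ _+_ (sumBelow-cong bs-2*2* n) (sumBelow-zero bs-2*[1+2*] n) ⟩
  sumBelow bs n + 0                                          ≡⟨ +-identityʳ _ ⟩
  sumBelow bs n                                              ∎
  where open ≡-Reasoning

sumBelow-bs-4^-≤ : ∀ J → sumBelow bs (4 ^ J) + sumBelow (λ i → bs (2 * i)) (4 ^ J) ≤ 2 * 3 ^ J
sumBelow-bs-4^-≤ zero    = ≤-refl
sumBelow-bs-4^-≤ (suc J) = begin
  S (4 * x) + E (4 * x)                 ≡⟨ cong (λ y → S y + E y) (*-assoc 2 2 x) ⟩
  S (2 * (2 * x)) + E (2 * (2 * x))     ≡⟨ cong₂ _+_ (trans (sumBelow-bs-2* (2 * x)) (cong₂ _+_ (sumBelow-bs-even-2* x) (sumBelow-bs-2* x)))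
                                                     (trans (sumBelow-bs-even-2* (2 * x)) (sumBelow-bs-2* x)) ⟩
  S x + (E x + S x) + (E x + S x)       ≤⟨ m≤m+n _ (E x) ⟩
  S x + (E x + S x) + (E x + S x) + E x ≡⟨ three-copies (S x) (E x) ⟩
  3 * (S x + E x)                       ≤⟨ *-monoʳ-≤ 3 (sumBelow-bs-4^-≤ J) ⟩
  3 * (2 * 3 ^ J)                       ≡⟨ *-comm-middle 3 2 (3 ^ J) ⟩
  2 * 3 ^ suc J                         ∎
  where
  open ≤-Reasoning
  x = 4 ^ J
  S = sumBelow bs
  E = sumBelow (λ i → bs (2 * i))
  three-copies : ∀ s e → s + (e + s) + (e + s) + e ≡ 3 * (s + e)
  three-copies = solve-∀
  *-comm-middle : ∀ a b c → a * (b * c) ≡ b * (a * c)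
  *-comm-middle = solve-∀

sumBs-4^-≤ : ∀ J → sumBs (4 ^ J) ≤ 3 ^ suc J
sumBs-4^-≤ J = begin
  sumBelow bs (suc (4 ^ J))             ≡⟨ sumBelow-suc bs (4 ^ J) ⟩
  sumBelow bs (4 ^ J) + bs (4 ^ J)      ≡⟨ cong (sumBelow bs (4 ^ J) +_) (bs-4^ J) ⟩
  sumBelow bs (4 ^ J) + 1               ≤⟨ +-monoˡ-≤ 1 (m+n≤o⇒m≤o _ (sumBelow-bs-4^-≤ J)) ⟩
  2 * 3 ^ J + 1                         ≤⟨ +-monoʳ-≤ (2 * 3 ^ J) (m^n>0 3 J) ⟩
  2 * 3 ^ J + 3 ^ J                     ≡⟨ 2*x+x≡3*x (3 ^ J) ⟩
  3 ^ suc J                             ∎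
  where
  open ≤-Reasoning
  2*x+x≡3*x : ∀ x → 2 * x + x ≡ 3 * x
  2*x+x≡3*x = solve-∀

sumBs-<-bs≡1 : ∀ {m n} → m < n → bs n ≡ 1 → sumBs m < sumBs n
sumBs-<-bs≡1 {m} {n} m<n bsn≡1 = begin-strict
  sumBelow bs (suc m)       ≤⟨ sumBelow-mono-≤ bs m<n ⟩
  sumBelow bs n             <⟨ m<m+n _ (s≤s z≤n) ⟩
  sumBelow bs n + 1         ≡⟨ cong (sumBelow bs n +_) bsn≡1 ⟨
  sumBelow bs n + bs n      ≡⟨ sumBelow-suc bs n ⟨
  sumBelow bs (suc n)       ∎
  where open ≤-Reasoning

3^[7+3k]<2^[12+5k] : ∀ k → 3 ^ (7 + 3 * k) < 2 ^ (12 + 5 * k)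
3^[7+3k]<2^[12+5k] k = begin-strict
  3 ^ (7 + 3 * k)       ≡⟨ ^-distribˡ-+-* 3 7 (3 * k) ⟩
  2187 * 3 ^ (3 * k)    ≡⟨ cong (2187 *_) (^-*-assoc 3 3 k) ⟨
  2187 * 27 ^ k         <⟨ *-monoˡ-< (27 ^ k) {{m^n≢0 27 k}} (≤ᵇ⇒≤ 2188 4096 tt) ⟩
  4096 * 27 ^ k         ≤⟨ *-monoʳ-≤ 4096 (^-monoˡ-≤ k (≤ᵇ⇒≤ 27 32 tt)) ⟩
  4096 * 32 ^ k         ≡⟨ cong (4096 *_) (^-*-assoc 2 5 k) ⟩
  4096 * 2 ^ (5 * k)    ≡⟨ ^-distribˡ-+-* 2 12 (5 * k) ⟨
  2 ^ (12 + 5 * k)      ∎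
  where open ≤-Reasoning

length-bits-sumBs-4^ : ∀ k → k + length (bits (sumBs (4 ^ (6 + 3 * k)))) ≤ 2 * (6 + 3 * k)
length-bits-sumBs-4^ k = begin
  k + length (bits (sumBs (4 ^ (6 + 3 * k)))) ≤⟨ +-monoʳ-≤ k (length-bits-< _ (12 + 5 * k) sumBs<2^[12+5k]) ⟩
  k + (12 + 5 * k)                            ≡⟨ exponents k ⟩
  2 * (6 + 3 * k)                             ∎
  where
  open ≤-Reasoning
  sumBs<2^[12+5k] : sumBs (4 ^ (6 + 3 * k)) < 2 ^ (12 + 5 * k)
  sumBs<2^[12+5k] = ≤-<-trans (sumBs-4^-≤ (6 + 3 * k)) (3^[7+3k]<2^[12+5k] k)
  exponents : ∀ k → k + (12 + 5 * k) ≡ 2 * (6 + 3 * k)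
  exponents = solve-∀

iterate-+ : ∀ (f : A → A) x m n → iterate f x (m + n) ≡ iterate f (iterate f x m) n
iterate-+ f x zero    n = refl
iterate-+ f x (suc m) n = iterate-+ f (f x) m n

foldl-replicate : ∀ (f : B → A → B) x a n → foldl f x (replicate n a) ≡ iterate (λ y → f y a) x n
foldl-replicate f x a zero    = refl
foldl-replicate f x a (suc n) = foldl-replicate f (f x a) a n

iterate-eventuallyPeriodic : ∀ {k} (f : Fin k → Fin k) x →
  ∃[ p ] ∀ g → k ≤ g → iterate f x g ≡ iterate f x (g + suc p)
iterate-eventuallyPeriodic {k} f x
  with i , j , i<j , fⁱx≡fʲx ← pigeonhole (n<1+n k) (λ i → iterate f x (toℕ i))
  = p , periodic
  where
  a = toℕ i
  b = toℕ j
  p = b ∸ suc a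
  b≡a+1+p : b ≡ a + suc p
  b≡a+1+p = sym (trans (+-suc a p) (m+[n∸m]≡n i<j))
  periodic : ∀ g → k ≤ g → iterate f x g ≡ iterate f x (g + suc p)
  periodic g k≤g = begin
    iterate f x g                          ≡⟨ cong (iterate f x) a+e≡g ⟨
    iterate f x (a + e)                    ≡⟨ iterate-+ f x a e ⟩
    iterate f (iterate f x a) e            ≡⟨ cong (λ y → iterate f y e) fⁱx≡fʲx ⟩
    iterate f (iterate f x b) e            ≡⟨ iterate-+ f x b e ⟨
    iterate f x (b + e)                    ≡⟨ cong (iterate f x) b+e≡g+1+p ⟩
    iterate f x (g + suc p)                ∎
    where
    open ≡-Reasoning
    e = g ∸ a
    a+e≡g : a + e ≡ g
    a+e≡g = m+[n∸m]≡n (≤-trans (<⇒≤ (<-≤-trans i<j (≤-pred (toℕ<n j)))) k≤g)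
    b+e≡g+1+p : b + e ≡ g + suc p
    b+e≡g+1+p = begin
      b + e           ≡⟨ cong (_+ e) b≡a+1+p ⟩
      a + suc p + e   ≡⟨ xy∙z≈xz∙y a (suc p) e ⟩
      a + e + suc p   ≡⟨ cong (_+ suc p) a+e≡g ⟩
      g + suc p       ∎

module _ {k} (M : DFA k) where
  open DFA M

  run-++-replicate-++ : ∀ u a g w →
    run M (u ++ replicate g a ++ w) ≡ accept (foldl step (iterate (λ s → step s a) (foldl step start u) g) w)
  run-++-replicate-++ u a g w = cong accept (begin
    foldl step start (u ++ replicate g a ++ w)    ≡⟨ foldl-++ step start u (replicate g a ++ w) ⟩
    foldl step s₀ (replicate g a ++ w)            ≡⟨ foldl-++ step s₀ (replicate g a) w ⟩
    foldl step (foldl step s₀ (replicate g a)) w  ≡⟨ cong (λ s → foldl step s w) (foldl-replicate step s₀ a g) ⟩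
    foldl step (iterate (λ s → step s a) s₀ g) w  ∎)
    where
    open ≡-Reasoning
    s₀ = foldl step start u

  run-pump : ∀ u a →
    ∃[ p ] ∀ g w → k ≤ g → run M (u ++ replicate g a ++ w) ≡ run M (u ++ replicate (g + suc p) a ++ w)
  run-pump u a with p , periodic ← iterate-eventuallyPeriodic (λ s → step s a) (foldl step start u)
    = p , λ g w k≤g → begin
      run M (u ++ replicate g a ++ w)                 ≡⟨ run-++-replicate-++ u a g w ⟩
      accept (foldl step (iterate δ s₀ g) w)          ≡⟨ cong (λ s → accept (foldl step s w)) (periodic g k≤g) ⟩
      accept (foldl step (iterate δ s₀ (g + suc p)) w) ≡⟨ run-++-replicate-++ u a (g + suc p) w ⟨
      run M (u ++ replicate (g + suc p) a ++ w)       ∎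
    where
    open ≡-Reasoning
    s₀ = foldl step start u
    δ = λ s → step s a

padZip : List Bool → List Bool → List (Bool × Bool)
padZip xs ys = zip (pad L xs) (pad L ys)
  where L = length xs ⊔ length ys

padZip-leadingOne : ∀ g ys → let ℓ = length ys in
  padZip (true ∷ replicate (g + ℓ) false) ys ≡ (true , false) ∷ replicate g (false , false) ++ zip (replicate ℓ false) ys
padZip-leadingOne g ys = begin
  zip (pad L xs) (pad L ys)                                         ≡⟨ cong₂ zip pad-xs pad-ys ⟩
  zip xs (false ∷ replicate g false ++ ys)                          ≡⟨ cong (λ zs → (true , false) ∷ zip zs (replicate g false ++ ys)) (replicate-++ g ℓ false) ⟨
  (true , false) ∷ zip (replicate g false ++ replicate ℓ false) (replicate g false ++ ys)
    ≡⟨ cong ((true , false) ∷_) (zip-replicate-++ g false false (replicate ℓ false) ys) ⟩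
  (true , false) ∷ replicate g (false , false) ++ zip (replicate ℓ false) ys ∎
  where
  open ≡-Reasoning
  ℓ = length ys
  xs = true ∷ replicate (g + ℓ) false
  L = length xs ⊔ ℓ
  length-xs : length xs ≡ suc (g + ℓ)
  length-xs = cong suc (length-replicate (g + ℓ))
  L≡1+g+ℓ : L ≡ suc (g + ℓ)
  L≡1+g+ℓ = trans (cong (_⊔ ℓ) length-xs) (m≥n⇒m⊔n≡m (m≤n⇒m≤1+n (m≤n+m ℓ g)))
  pad-xs : pad L xs ≡ xs
  pad-xs = cong (λ n → replicate n false ++ xs) (trans (cong₂ _∸_ L≡1+g+ℓ length-xs) (n∸n≡0 (suc (g + ℓ))))
  pad-ys : pad L ys ≡ false ∷ replicate g false ++ ys
  pad-ys = cong (λ n → replicate n false ++ ys) (trans (cong (_∸ ℓ) L≡1+g+ℓ) (m+n∸n≡m (suc g) ℓ))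

pairWord-4^ : ∀ g J m → g + length (bits m) ≡ 2 * J →
  pairWord (4 ^ J) m ≡ [ (true , false) ] ++ replicate g (false , false) ++ zip (replicate (length (bits m)) false) (bits m)
pairWord-4^ g J m g+ℓ≡2J = begin
  padZip (bits (4 ^ J)) (bits m)                                 ≡⟨ cong (λ xs → padZip xs (bits m)) (bits-4^ J) ⟩
  padZip (true ∷ replicate (2 * J) false) (bits m)               ≡⟨ cong (λ n → padZip (true ∷ replicate n false) (bits m)) g+ℓ≡2J ⟨
  padZip (true ∷ replicate (g + length (bits m)) false) (bits m) ≡⟨ padZip-leadingOne g (bits m) ⟩
  (true , false) ∷ replicate g (false , false) ++ zip (replicate (length (bits m)) false) (bits m) ∎
  where open ≡-Reasoning

pairWord-4^-pump : ∀ {k} (M : DFA k) →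
  ∃[ p ] ∀ J m → k + length (bits m) ≤ 2 * J → run M (pairWord (4 ^ J) m) ≡ run M (pairWord (4 ^ (J + suc p)) m)
pairWord-4^-pump {k} M with p , pumped ← run-pump M [ (true , false) ] (false , false) = p , pump-4^
  where
  u = [ (true , false) ]
  a = (false , false)
  P = suc p
  pump-4^ : ∀ J m → k + length (bits m) ≤ 2 * J → run M (pairWord (4 ^ J) m) ≡ run M (pairWord (4 ^ (J + P)) m)
  pump-4^ J m k+ℓ≤2J = begin
    run M (pairWord (4 ^ J) m)                 ≡⟨ cong (run M) (pairWord-4^ g J m g+ℓ≡2J) ⟩
    run M (u ++ replicate g a ++ R)            ≡⟨ pumped g R k≤g ⟩
    run M (u ++ replicate (g + P) a ++ R)      ≡⟨ pumped (g + P) R (≤-trans k≤g (m≤m+n g P)) ⟩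
    run M (u ++ replicate (g + P + P) a ++ R)  ≡⟨ cong (run M) (pairWord-4^ (g + P + P) (J + P) m g+2P+ℓ≡2[J+P]) ⟨
    run M (pairWord (4 ^ (J + P)) m)           ∎
    where
    open ≡-Reasoning
    ℓ = length (bits m)
    R = zip (replicate ℓ false) (bits m)
    g = 2 * J ∸ ℓ
    k≤g : k ≤ g
    k≤g = m+n≤o⇒m≤o∸n k k+ℓ≤2J
    g+ℓ≡2J : g + ℓ ≡ 2 * J
    g+ℓ≡2J = m∸n+n≡m (m+n≤o⇒n≤o k k+ℓ≤2J)
    regroup : ∀ g P ℓ → g + P + P + ℓ ≡ (g + ℓ) + 2 * P
    regroup = solve-∀
    g+2P+ℓ≡2[J+P] : g + P + P + ℓ ≡ 2 * (J + P)
    g+2P+ℓ≡2[J+P] = begin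
      g + P + P + ℓ     ≡⟨ regroup g P ℓ ⟩
      (g + ℓ) + 2 * P   ≡⟨ cong (_+ 2 * P) g+ℓ≡2J ⟩
      2 * J + 2 * P     ≡⟨ *-distribˡ-+ 2 J P ⟨
      2 * (J + P)       ∎

mainTheorem2 : ¬ Synchronised2 sumBs
mainTheorem2 (k , M , synchronised) with p , pumped ← pairWord-4^-pump M = <-irrefl m≡m′ m<m′
  where
  J = 6 + 3 * k
  J′ = J + suc p
  m = sumBs (4 ^ J)
  accepted′ : run M (pairWord (4 ^ J′) m) ≡ true
  accepted′ = trans (sym (pumped J m (length-bits-sumBs-4^ k))) (Equivalence.from (synchronised (4 ^ J) m) refl)
  m≡m′ : m ≡ sumBs (4 ^ J′)
  m≡m′ = Equivalence.to (synchronised (4 ^ J′) m) accepted′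
  m<m′ : m < sumBs (4 ^ J′)
  m<m′ = sumBs-<-bs≡1 (^-monoʳ-< 4 (s≤s (s≤s z≤n)) (m<m+n J (s≤s z≤n))) (bs-4^ J′)
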